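{- Let $n\ge1$ and let $N$ be a subsemigroup of $B(n)$ containing $0$. The following are equivalent: (i) $N$ is a nilpotent semigroup; (ii) the binary relation $N\setminus\{0\}$ on $\{1,\dots,n\}$ is irreflexive and transitive, i.e. a strict partial order; (iii) the directed graph $\Gamma(N)$ is acyclic.
   Context: For $n\ge1$, $B(n)$ denotes the aperiodic Brandt semigroup: the set $(\{1,\dots,n\}\times\{1,\dots,n\})\cup\{0\}$, where $0$ is a zero element and $(i,j)(k,l)=(i,l)$ if $j=k$ and $(i,j)(k,l)=0$ otherwise. A nonzero element $(i,j)$ is viewed as the pair $(i,j)$ of a binary relation on $\{1,\dots,n\}$. A semigroup $N$ with zero $0$ is nilpotent if $N^k=\{0\}$ for some positive integer $k$ (the product of any $k$ elements is $0$). For $N\subseteq B(n)$, $\Gamma(N)$ is the directed graph with vertex set $\{1,\dots,n\}$ and an edge $i\to j$ for each $(i,j)\in N$ (loops allowed); acyclic means it has no directed cycle (including loops). -}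

module Defs where

open import Data.Nat using (ℕ; suc)
open import Data.Fin using (Fin; _≟_)
open import Data.Product using (_×_; _,_; ∃-syntax)
open import Data.Maybe using (Maybe; just; nothing)
open import Data.Vec using (Vec; _∷_; [])
open import Data.Vec.Relation.Unary.All using (All)
open import Data.Empty using (⊥)
open import Relation.Nullary using (¬_; yes; no)
open import Relation.Binary.PropositionalEquality using (_≡_)
open import Relation.Binary.Construct.Closure.Transitive using (TransClosure)

-- The aperiodic Brandt semigroup B(n): nothing = 0, just (i , j) = (i,j).
B : ℕ → Set
B n = Maybe (Fin n × Fin n)

zeroB : ∀ {n} → B n
zeroB = nothing

_·_ : ∀ {n} → B n → B n → B n
nothing · _ = nothing
just _ · nothing = nothing
just (i , j) · just (k , l) with j ≟ k
... | yes _ = just (i , l)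
... | no _ = nothing

Subset : ℕ → Set₁
Subset n = B n → Set

IsSubsemigroupWithZero : ∀ {n} → Subset n → Set
IsSubsemigroupWithZero {n} N =
  N zeroB × (∀ (x y : B n) → N x → N y → N (x · y))

prod : ∀ {n m} → Vec (B n) (suc m) → B n
prod (x ∷ []) = x
prod (x ∷ y ∷ xs) = x · prod (y ∷ xs)

Nilpotent : ∀ {n} → Subset n → Set
Nilpotent {n} N =
  ∃[ m ] (∀ (xs : Vec (B n) (suc m)) → All N xs → prod xs ≡ zeroB)

Rel⁰ : ∀ {n} → Subset n → Fin n → Fin n → Set
Rel⁰ N i j = N (just (i , j))

StrictPartialOrder : ∀ {n} → (Fin n → Fin n → Set) → Set
StrictPartialOrder {n} R =
  (∀ i → ¬ R i i) × (∀ i j k → R i j → R j k → R i k)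

Edge : ∀ {n} → Subset n → Fin n → Fin n → Set
Edge N i j = N (just (i , j))

Acyclic : ∀ {n} → (Fin n → Fin n → Set) → Set
Acyclic {n} E = ∀ (i : Fin n) → ¬ TransClosure E i i

module Submission where

-- Write R for the relation N \ {0} on {1,…,n}.  The only place where N
-- being a subsemigroup matters is that R is then transitive, since
-- (i,j)(j,k) = (i,k).  Everything else is a statement about R alone:
--
--  * (i,i) is idempotent, so if (i,i) ∈ N then every power of it is
--    nonzero; hence nilpotent N forces R irreflexive.
--  * a nonzero product x₁⋯x_{m+1} of elements of N must be of the form
--    (v₀,v₁)(v₁,v₂)⋯(v_m,v_{m+1}); when R is transitive the vertices
--    v₀,…,v_m form a chain v₀ R v₁ R ⋯ R v_m.  For m = n the pigeonhole
--    principle repeats a vertex, contradicting irreflexivity; so a strict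
--    partial order R makes N^{n+1} = {0}.
--  * a strict partial order has no cycles (a cycle collapses under
--    transitivity to a loop), and an acyclic graph has no loops.

open import Defs
open import Data.Nat using (ℕ; _≥_; suc; zero; z<s; s<s)
import Data.Nat as ℕ
open import Data.Nat.Properties using (n<1+n)
open import Data.Product using (_×_; _,_; ∃-syntax)
open import Function.Bundles using (_⇔_; mk⇔)
open import Data.Fin using (Fin; _≟_; _<_) renaming (zero to fzero; suc to fsuc)
open import Data.Fin.Properties using (pigeonhole)
open import Data.Maybe using (just; nothing)
open import Data.Vec using (Vec; _∷_; []; replicate)
open import Data.Vec.Functional using (head) renaming (_∷_ to _◂_)
open import Data.Vec.Relation.Unary.All using (All; _∷_; [])
open import Data.Empty using (⊥-elim)
open import Relation.Nullary using (¬_; yes; no; contradiction)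
open import Relation.Binary.Core using (Rel)
open import Relation.Binary.Definitions using (Transitive)
open import Relation.Binary.PropositionalEquality
  using (_≡_; refl; subst; sym; trans; cong; module ≡-Reasoning)
open import Relation.Binary.Construct.Closure.Transitive using ([_]; transitive⁻)

·-match : ∀ {n} (i j k : Fin n) → just (i , j) · just (j , k) ≡ just (i , k)
·-match i j k with j ≟ j
... | yes _ = refl
... | no j≢j = contradiction refl j≢j

·-nonzero : ∀ {n} (x y : B n) {a b} → x · y ≡ just (a , b) →
  ∃[ c ] x ≡ just (a , c) × y ≡ just (c , b)
·-nonzero (just (i , j)) (just (k , l)) eq with j ≟ k
·-nonzero (just (i , j)) (just (.j , l)) refl | yes refl = j , refl , refl
·-nonzero (just (i , j)) (just (k , l)) () | no _

prod-replicate : ∀ {n} {e : B n} → e · e ≡ e → ∀ m → prod (replicate (suc m) e) ≡ e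
prod-replicate ee zero = refl
prod-replicate {e = e} ee (suc m) = begin
  e · prod (replicate (suc m) e) ≡⟨ cong (e ·_) (prod-replicate ee m) ⟩
  e · e                          ≡⟨ ee ⟩
  e                              ∎
  where open ≡-Reasoning

all-replicate : ∀ {n} {N : Subset n} {x} m → N x → All N (replicate m x)
all-replicate zero    _  = []
all-replicate (suc m) px = px ∷ all-replicate m px

Irreflexive : ∀ {n} → Rel (Fin n) _ → Set
Irreflexive R = ∀ i → ¬ R i i

Increasing : ∀ {n m} → Rel (Fin n) _ → (Fin m → Fin n) → Set
Increasing R f = ∀ {i j} → i < j → R (f i) (f j)

increasing-single : ∀ {n} {R : Rel (Fin n) _} (f : Fin 1 → Fin n) → Increasing R f
increasing-single f {fzero} {fzero} ()

increasing-cons : ∀ {n m} {R : Rel (Fin n) _} → Transitive R →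
  ∀ {a} {f : Fin (suc m) → Fin n} →
  R a (head f) → Increasing R f → Increasing R (a ◂ f)
increasing-cons tr a→f₀ inc {fzero} {fsuc fzero}    _ = a→f₀
increasing-cons tr a→f₀ inc {fzero} {fsuc (fsuc j)} _ = tr a→f₀ (inc {fzero} {fsuc j} z<s)
increasing-cons tr a→f₀ inc {fsuc i} {fsuc j} (s<s i<j) = inc i<j

no-long-chain : ∀ {n m} {R : Rel (Fin n) _} → Irreflexive R →
  n ℕ.< m → (f : Fin m → Fin n) → ¬ Increasing R f
no-long-chain {R = R} irr n<m f inc with pigeonhole n<m f
... | i , j , i<j , fi≡fj = irr (f j) (subst (λ v → R v (f j)) fi≡fj (inc i<j))

-- A strict partial order is acyclic: a cycle collapses to a loop.
spo⇒acyclic : ∀ {n} {R : Rel (Fin n) _} → StrictPartialOrder R → Acyclic R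
spo⇒acyclic {R = R} (irr , tr) i cycle = irr i (transitive⁻ R (tr _ _ _) cycle)

acyclic⇒irreflexive : ∀ {n} {R : Rel (Fin n) _} → Acyclic R → Irreflexive R
acyclic⇒irreflexive acyclic i loop = acyclic i [ loop ]

module _ {n} (N : Subset n) where

  rel-transitive : IsSubsemigroupWithZero N → Transitive (Rel⁰ N)
  rel-transitive (_ , closed) {i} {j} {k} ij jk =
    subst N (·-match i j k) (closed _ _ ij jk)

  irreflexive⇒spo : IsSubsemigroupWithZero N → Irreflexive (Rel⁰ N) →
    StrictPartialOrder (Rel⁰ N)
  irreflexive⇒spo S irr = irr , λ _ _ _ → rel-transitive S

  -- If (i,i) ∈ N, its powers are all (i,i) ≠ 0, so N is not nilpotent.
  nilpotent⇒irreflexive : Nilpotent N → Irreflexive (Rel⁰ N)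
  nilpotent⇒irreflexive (m , kills) i ii
    with trans (sym (prod-replicate (·-match i i i) m)) (kills _ (all-replicate (suc m) ii))
  ... | ()

  product-chain : Transitive (Rel⁰ N) → ∀ {m} (xs : Vec (B n) (suc m)) → All N xs →
    ∀ {a b} → prod xs ≡ just (a , b) →
    ∃[ f ] f fzero ≡ a × Increasing {m = suc m} (Rel⁰ N) f
  product-chain tr (x ∷ []) (px ∷ []) {a} refl = (λ _ → a) , refl , increasing-single {R = Rel⁰ N} _
  product-chain tr (x ∷ y ∷ ys) (px ∷ pys) {a} eq
    with ·-nonzero x (prod (y ∷ ys)) eq
  ... | c , refl , rest≡cb with product-chain tr (y ∷ ys) pys rest≡cb
  ... | f , f₀≡c , inc =
    a ◂ f , refl , increasing-cons {R = Rel⁰ N} tr (subst (Rel⁰ N a) (sym f₀≡c) px) inc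

  spo⇒nilpotent : StrictPartialOrder (Rel⁰ N) → Nilpotent N
  spo⇒nilpotent (irr , tr) = n , kills
    where
    kills : (xs : Vec (B n) (suc n)) → All N xs → prod xs ≡ zeroB
    kills xs pxs with prod xs in eq
    ... | nothing = refl
    ... | just _ with product-chain (tr _ _ _) xs pxs eq
    ... | f , _ , inc = ⊥-elim (no-long-chain {R = Rel⁰ N} irr (n<1+n n) f inc)

theorem5p4 : (n : ℕ) → n ≥ 1 → (N : Subset n) → IsSubsemigroupWithZero N →
    (Nilpotent N ⇔ StrictPartialOrder (Rel⁰ N))
    × (StrictPartialOrder (Rel⁰ N) ⇔ Acyclic (Edge N))
theorem5p4 n _ N S =
  mk⇔ (λ nil → irreflexive⇒spo N S (nilpotent⇒irreflexive N nil)) (spo⇒nilpotent N) ,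
  mk⇔ spo⇒acyclic (λ acyclic → irreflexive⇒spo N S (acyclic⇒irreflexive acyclic))
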